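{- Let $\Sigma=\{0,1,2,3\}$ and let $C,C'\subseteq\Sigma^n$ be prime double-codes that are both included in the same complementable double-code. Then $C=C'$ or $C\cap C'=\emptyset$.
   Context: A line of $\Sigma^n$ is a set of four words differing only in one fixed coordinate. A double-code meets every line in $0$ or $2$ elements; a double-MDS-code meets every line in exactly $2$ elements. A double-code is complementable if it is a subset of some double-MDS-code. It is prime if it is complementable, nonempty, and cannot be split into more than one nonempty double-codes. -}

module Defs where

open import Data.Nat using (ℕ; _+_; _≤_)
open import Data.Fin using (Fin)
open import Data.Vec using (Vec; _[_]≔_)
open import Data.Bool using (Bool; true; false; if_then_else_)
open import Data.Product using (Σ; ∃; _×_; _,_)
open import Data.Sum using (_⊎_)
open import Data.Empty using (⊥)
open import Relation.Binary.PropositionalEquality using (_≡_; _≢_)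

Sym : Set
Sym = Fin 4

Word : ℕ → Set
Word n = Vec Sym n

Code : ℕ → Set
Code n = Word n → Bool

_∈_ : ∀ {n} → Word n → Code n → Set
x ∈ C = C x ≡ true

lineCount : ∀ {n} → Code n → Word n → Fin n → ℕ
lineCount C x i = ind Fin.zero + ind (Fin.suc Fin.zero)
                  + ind (Fin.suc (Fin.suc Fin.zero))
                  + ind (Fin.suc (Fin.suc (Fin.suc Fin.zero)))
  where
  ind : Sym → ℕ
  ind a = if C (x [ i ]≔ a) then 1 else 0

IsDoubleCode : ∀ {n} → Code n → Set
IsDoubleCode C = ∀ x i → (lineCount C x i ≡ 0) ⊎ (lineCount C x i ≡ 2)

IsDoubleMDS : ∀ {n} → Code n → Set
IsDoubleMDS C = ∀ x i → lineCount C x i ≡ 2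

_⊆_ : ∀ {n} → Code n → Code n → Set
C ⊆ D = ∀ x → x ∈ C → x ∈ D

IsComplementable : ∀ {n} → Code n → Set
IsComplementable {n} C = IsDoubleCode C × Σ (Code n) (λ M → IsDoubleMDS M × C ⊆ M)

Nonempty : ∀ {n} → Code n → Set
Nonempty C = ∃ λ x → x ∈ C

record Splitting {n : ℕ} (C : Code n) (k : ℕ) : Set where
  field
    part     : Fin k → Code n
    doubleP  : ∀ j → IsDoubleCode (part j)
    nonemptyP : ∀ j → Nonempty (part j)
    disjointP : ∀ j j' → j ≢ j' → ∀ x → x ∈ part j → x ∈ part j' → ⊥
    coverP   : ∀ x → x ∈ C → ∃ λ j → x ∈ part j
    subP     : ∀ j → part j ⊆ C

IsPrime : ∀ {n} → Code n → Set
IsPrime C = IsComplementable C × Nonempty C × (∀ k → 2 ≤ k → Splitting C k → ⊥)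

{-# OPTIONS --safe #-}
module Submission where

-- Every line meets a double-MDS code M in exactly two words, so a double-code C ⊆ M
-- meets each line either not at all or in exactly the two words of M on it.  Such
-- all-or-nothing traces are closed under intersection and difference; hence for
-- double-codes C, C' ⊆ M both C ∩ C' and C ∖ C' are double-codes, and if both are
-- nonempty they split C.  So a prime C is disjoint from C' or contained in it, and
-- applying this in both directions gives the claim.

open import Defs
open import Data.Nat using (ℕ; zero; suc; _+_; _≤_; s≤s; z≤n)
open import Data.Nat.Properties using (suc-injective; 1+n≰n)
open import Data.Nat.Tactic.RingSolver using (solve-∀)
open import Data.Bool using (Bool; true; false; _∧_; not; if_then_else_; _≟_)
open import Data.Fin using (Fin; zero; suc; #_)
open import Data.Fin.Properties using (any?)
open import Data.Fin.Subset
  using (Subset; inside; outside; _∩_; ∁; ∣_∣)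
  renaming (⊥ to ∅; _⊆_ to _⊆ˢ_; _∈_ to _∈ˢ_)
open import Data.Fin.Subset.Properties
  using (drop-∷-⊆; p⊆q⇒∣p∣≤∣q∣; ∣⊥∣≡0; ∩-zeroˡ; ∩-zeroʳ; ∩-idem; ∩-identityʳ; ∩-inverseʳ)
open import Data.Vec using ([]; _∷_; here; tabulate; map; sum; _[_]≔_)
open import Data.Vec.Properties using (map-replicate; lookup∘tabulate; []=⇒lookup; lookup⇒[]=)
open import Data.Product using (_×_; _,_; proj₁)
open import Data.Sum using (_⊎_; inj₁; inj₂)
import Data.Sum as Sum
open import Data.Empty using (⊥; ⊥-elim)
open import Function using (_∘_)
open import Relation.Nullary using (Dec; yes; no; ¬_; contradiction)
open import Relation.Nullary.Decidable using (map′)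
open import Relation.Binary.PropositionalEquality
  using (_≡_; _≢_; refl; sym; trans; cong; cong₂; subst)

private
  variable
    k n : ℕ

AllOrNothing : Subset k → Subset k → Set
AllOrNothing m p = p ≡ ∅ ⊎ p ≡ m

∣p∣≡0⇒p≡∅ : {p : Subset k} → ∣ p ∣ ≡ 0 → p ≡ ∅
∣p∣≡0⇒p≡∅ {p = []}          _ = refl
∣p∣≡0⇒p≡∅ {p = outside ∷ p} h = cong (outside ∷_) (∣p∣≡0⇒p≡∅ h)

p⊆q⇒∣p∣≡∣q∣⇒p≡q : {p q : Subset k} → p ⊆ˢ q → ∣ p ∣ ≡ ∣ q ∣ → p ≡ q
p⊆q⇒∣p∣≡∣q∣⇒p≡q {p = []}          {[]}          _   _ = refl
p⊆q⇒∣p∣≡∣q∣⇒p≡q {p = outside ∷ p} {outside ∷ q} p⊆q h =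
  cong (outside ∷_) (p⊆q⇒∣p∣≡∣q∣⇒p≡q (drop-∷-⊆ p⊆q) h)
p⊆q⇒∣p∣≡∣q∣⇒p≡q {p = inside ∷ p}  {inside ∷ q}  p⊆q h =
  cong (inside ∷_) (p⊆q⇒∣p∣≡∣q∣⇒p≡q (drop-∷-⊆ p⊆q) (suc-injective h))
p⊆q⇒∣p∣≡∣q∣⇒p≡q {p = inside ∷ p}  {outside ∷ q} p⊆q _ = contradiction (p⊆q here) λ ()
p⊆q⇒∣p∣≡∣q∣⇒p≡q {p = outside ∷ p} {inside ∷ q}  p⊆q h =
  contradiction (subst (λ s → s ≤ ∣ q ∣) h (p⊆q⇒∣p∣≤∣q∣ (drop-∷-⊆ p⊆q))) 1+n≰n

size⇒allOrNothing : {m p : Subset k} → p ⊆ˢ m → ∣ p ∣ ≡ 0 ⊎ ∣ p ∣ ≡ ∣ m ∣ → AllOrNothing m p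
size⇒allOrNothing p⊆m = Sum.map ∣p∣≡0⇒p≡∅ (p⊆q⇒∣p∣≡∣q∣⇒p≡q p⊆m)

allOrNothing⇒size : {m p : Subset k} → AllOrNothing m p → ∣ p ∣ ≡ 0 ⊎ ∣ p ∣ ≡ ∣ m ∣
allOrNothing⇒size {k} (inj₁ refl) = inj₁ (∣⊥∣≡0 k)
allOrNothing⇒size (inj₂ refl) = inj₂ refl

allOrNothing-∩ : {m p q : Subset k} → AllOrNothing m p → AllOrNothing m q → AllOrNothing m (p ∩ q)
allOrNothing-∩ {q = q} (inj₁ refl) _           = inj₁ (∩-zeroˡ q)
allOrNothing-∩ {m = m} (inj₂ refl) (inj₁ refl) = inj₁ (∩-zeroʳ m)
allOrNothing-∩ {m = m} (inj₂ refl) (inj₂ refl) = inj₂ (∩-idem m)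

allOrNothing-∩∁ : {m p q : Subset k} → AllOrNothing m p → AllOrNothing m q → AllOrNothing m (p ∩ ∁ q)
allOrNothing-∩∁ {q = q} (inj₁ refl) _           = inj₁ (∩-zeroˡ (∁ q))
allOrNothing-∩∁ {k} {m} (inj₂ refl) (inj₁ refl) =
  inj₂ (trans (cong (m ∩_) (map-replicate not false k)) (∩-identityʳ m))
allOrNothing-∩∁ {m = m} (inj₂ refl) (inj₂ refl) = inj₁ (∩-inverseʳ m)

indicator : Bool → ℕ
indicator b = if b then 1 else 0

∣p∣≡sum : (p : Subset k) → ∣ p ∣ ≡ sum (map indicator p)
∣p∣≡sum []            = refl
∣p∣≡sum (inside ∷ p)  = cong suc (∣p∣≡sum p)
∣p∣≡sum (outside ∷ p) = ∣p∣≡sum p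

line : Code n → Word n → Fin n → Subset 4
line C x i = tabulate (λ a → C (x [ i ]≔ a))

lineCount≡∣line∣ : (C : Code n) (x : Word n) (i : Fin n) → lineCount C x i ≡ ∣ line C x i ∣
lineCount≡∣line∣ C x i =
  trans (+-reassoc (ind (# 0)) (ind (# 1)) (ind (# 2)) (ind (# 3))) (sym (∣p∣≡sum (line C x i)))
  where
  ind : Sym → ℕ
  ind a = indicator (C (x [ i ]≔ a))
  +-reassoc : ∀ a b c d → a + b + c + d ≡ a + (b + (c + (d + 0)))
  +-reassoc = solve-∀

line-⊆ : {C D : Code n} → C ⊆ D → (x : Word n) (i : Fin n) → line C x i ⊆ˢ line D x i
line-⊆ {C = C} {D} C⊆D x i {a} a∈ =
  lookup⇒[]= a (line D x i)
    (trans (lookup∘tabulate (λ b → D (x [ i ]≔ b)) a)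
      (C⊆D _ (trans (sym (lookup∘tabulate (λ b → C (x [ i ]≔ b)) a)) ([]=⇒lookup a∈))))

AllOrNothingOnLines : Code n → Code n → Set
AllOrNothingOnLines M C = ∀ x i → AllOrNothing (line M x i) (line C x i)

doubleCode⇒allOrNothingOnLines : {M C : Code n} →
  IsDoubleMDS M → IsDoubleCode C → C ⊆ M → AllOrNothingOnLines M C
doubleCode⇒allOrNothingOnLines {M = M} {C} mds dC C⊆M x i =
  size⇒allOrNothing (line-⊆ C⊆M x i) sizes
  where
  sizes : ∣ line C x i ∣ ≡ 0 ⊎ ∣ line C x i ∣ ≡ ∣ line M x i ∣
  sizes rewrite sym (lineCount≡∣line∣ C x i) | sym (lineCount≡∣line∣ M x i) | mds x i = dC x i

allOrNothingOnLines⇒doubleCode : {M C : Code n} →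
  IsDoubleMDS M → AllOrNothingOnLines M C → IsDoubleCode C
allOrNothingOnLines⇒doubleCode {M = M} {C} mds saturated x i rewrite lineCount≡∣line∣ C x i =
  Sum.map₂ (λ h → trans h ∣line-M∣≡2) (allOrNothing⇒size (saturated x i))
  where
  ∣line-M∣≡2 : ∣ line M x i ∣ ≡ 2
  ∣line-M∣≡2 = trans (sym (lineCount≡∣line∣ M x i)) (mds x i)

_∩ᶜ_ _─ᶜ_ : Code n → Code n → Code n
(C ∩ᶜ D) x = C x ∧ D x
(C ─ᶜ D) x = C x ∧ not (D x)

module _ {M C D : Code n} (mds : IsDoubleMDS M) (dC : IsDoubleCode C) (dD : IsDoubleCode D)
         (C⊆M : C ⊆ M) (D⊆M : D ⊆ M) where

  ∩ᶜ-isDoubleCode : IsDoubleCode (C ∩ᶜ D)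
  ∩ᶜ-isDoubleCode = allOrNothingOnLines⇒doubleCode {M = M} {C ∩ᶜ D} mds λ x i →
    allOrNothing-∩ (doubleCode⇒allOrNothingOnLines {M = M} mds dC C⊆M x i)
                   (doubleCode⇒allOrNothingOnLines {M = M} mds dD D⊆M x i)

  ─ᶜ-isDoubleCode : IsDoubleCode (C ─ᶜ D)
  ─ᶜ-isDoubleCode = allOrNothingOnLines⇒doubleCode {M = M} {C ─ᶜ D} mds λ x i →
    allOrNothing-∩∁ (doubleCode⇒allOrNothingOnLines {M = M} mds dC C⊆M x i)
                    (doubleCode⇒allOrNothingOnLines {M = M} mds dD D⊆M x i)

Disjoint : Code n → Code n → Set
Disjoint C D = ∀ x → x ∈ C → x ∈ D → ⊥

∧-≡-true : ∀ a b → a ∧ b ≡ true → a ≡ true × b ≡ true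
∧-≡-true true true refl = refl , refl

∩ᶜ-─ᶜ-disjoint : (C D : Code n) → Disjoint (C ∩ᶜ D) (C ─ᶜ D)
∩ᶜ-─ᶜ-disjoint C D x x∈C∩D x∈C─D
  with D x | ∧-≡-true (C x) _ x∈C∩D | ∧-≡-true (C x) _ x∈C─D
... | true | _ | _ , ()

∩ᶜ-or-─ᶜ : (C D : Code n) (x : Word n) → x ∈ C → x ∈ (C ∩ᶜ D) ⊎ x ∈ (C ─ᶜ D)
∩ᶜ-or-─ᶜ C D x x∈C with D x
... | true  = inj₁ (cong (_∧ true) x∈C)
... | false = inj₂ (cong (_∧ true) x∈C)

splitting₂ : (C D : Code n) → IsDoubleCode (C ∩ᶜ D) → IsDoubleCode (C ─ᶜ D) →
  Nonempty (C ∩ᶜ D) → Nonempty (C ─ᶜ D) → Splitting C 2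
splitting₂ {n} C D dC∩D dC─D ne∩ ne─ = record
  { part      = part
  ; doubleP   = λ { zero → dC∩D ; (suc zero) → dC─D }
  ; nonemptyP = λ { zero → ne∩ ; (suc zero) → ne─ }
  ; disjointP = disjoint
  ; coverP    = λ x x∈C → Sum.[ (λ p → zero , p) , (λ p → suc zero , p) ] (∩ᶜ-or-─ᶜ C D x x∈C)
  ; subP      = λ { zero x p → proj₁ (∧-≡-true (C x) _ p) ; (suc zero) x p → proj₁ (∧-≡-true (C x) _ p) }
  }
  where
  part : Fin 2 → Code n
  part zero       = C ∩ᶜ D
  part (suc zero) = C ─ᶜ D
  disjoint : ∀ j j' → j ≢ j' → ∀ x → x ∈ part j → x ∈ part j' → ⊥
  disjoint zero       zero       j≢j' _ _ _ = j≢j' refl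
  disjoint (suc zero) (suc zero) j≢j' _ _ _ = j≢j' refl
  disjoint zero       (suc zero) _    x p q = ∩ᶜ-─ᶜ-disjoint C D x p q
  disjoint (suc zero) zero       _    x p q = ∩ᶜ-─ᶜ-disjoint C D x q p

nonempty? : (C : Code n) → Dec (Nonempty C)
nonempty? {zero}  C = map′ ([] ,_) (λ { ([] , p) → p }) (C [] ≟ true)
nonempty? {suc n} C =
  map′ (λ (a , w , p) → a ∷ w , p) (λ { (a ∷ w , p) → a , w , p })
       (any? λ a → nonempty? (C ∘ (a ∷_)))

¬nonempty-─ᶜ⇒⊆ : (C D : Code n) → ¬ Nonempty (C ─ᶜ D) → C ⊆ D
¬nonempty-─ᶜ⇒⊆ C D empty x x∈C with D x in D[x]
... | true  = refl
... | false = ⊥-elim (empty (x , cong₂ (λ a b → a ∧ not b) x∈C D[x]))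

⊆-antisym : {C D : Code n} → C ⊆ D → D ⊆ C → ∀ x → C x ≡ D x
⊆-antisym {C = C} {D} C⊆D D⊆C x with C x in C[x] | D x in D[x]
... | true  | true  = refl
... | false | false = refl
... | true  | false = trans (sym (C⊆D x C[x])) D[x]
... | false | true  = trans (sym C[x]) (D⊆C x D[x])

⊆-trans : {C D E : Code n} → C ⊆ D → D ⊆ E → C ⊆ E
⊆-trans C⊆D D⊆E x = D⊆E x ∘ C⊆D x

prime⇒disjoint⊎⊆ : {M C D : Code n} → IsDoubleMDS M → IsPrime C → IsDoubleCode D →
  C ⊆ M → D ⊆ M → Disjoint C D ⊎ C ⊆ D
prime⇒disjoint⊎⊆ {C = C} {D} mds ((dC , _) , _ , unsplittable) dD C⊆M D⊆M
  with nonempty? (C ∩ᶜ D) | nonempty? (C ─ᶜ D)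
... | no none     | _         = inj₁ λ x x∈C x∈D → none (x , cong₂ _∧_ x∈C x∈D)
... | yes _       | no none   = inj₂ (¬nonempty-─ᶜ⇒⊆ C D none)
... | yes common  | yes rest  = ⊥-elim (unsplittable 2 (s≤s (s≤s z≤n))
  (splitting₂ C D (∩ᶜ-isDoubleCode mds dC dD C⊆M D⊆M)
                  (─ᶜ-isDoubleCode mds dC dD C⊆M D⊆M) common rest))

corollary1 : (n : ℕ) (C C' D : Code n) →
    IsPrime C → IsPrime C' → IsComplementable D → C ⊆ D → C' ⊆ D →
    (∀ x → C x ≡ C' x) ⊎ (∀ x → x ∈ C → x ∈ C' → ⊥)
corollary1 n C C' D primeC@((dC , _) , _) primeC'@((dC' , _) , _) (_ , M , mds , D⊆M) C⊆D C'⊆D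
  with prime⇒disjoint⊎⊆ mds primeC  dC' (⊆-trans C⊆D D⊆M) (⊆-trans C'⊆D D⊆M)
     | prime⇒disjoint⊎⊆ mds primeC' dC  (⊆-trans C'⊆D D⊆M) (⊆-trans C⊆D D⊆M)
... | inj₁ disjoint | _             = inj₂ disjoint
... | _             | inj₁ disjoint = inj₂ (λ x p q → disjoint x q p)
... | inj₂ C⊆C'     | inj₂ C'⊆C     = inj₁ (⊆-antisym C⊆C' C'⊆C)
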